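{- Let $\mathcal{M}=\langle S,T,V,U,\sim_i,\approx\rangle$ be a dependence epistemic model, $s\in S$, and $X,Y\subseteq\mathbb{V}$ finite. Then (1) $\mathcal{M},s\vDash\mathcal{D}_g(X,Y)$ iff there exist $u,v\in S$ with $u\approx v\approx s$ such that $\Delta(u,v)$ is an evidence of $\langle X,Y\rangle$; (2) $\mathcal{M},s\vDash\mathcal{D}_l(X,Y)$ iff there exists $t\in S$ with $t\approx s$ such that $\Delta(t,s)$ is an evidence of $\langle X,Y\rangle$.
   Context: Fix a countable set $\mathbb{P}$ of propositions and a countable set $\mathbb{V}$ of variables. A dependence epistemic model is $\mathcal{M}=\langle S,T,V,U,\sim_i,\approx\rangle$ where $S$ is a set of worlds, $T:S\times\mathbb{P}\to\{0,1\}$, $V\supseteq\mathbb{V}$ is a countable set of variables, $U:S\times V\to\mathbb{N}$, and $\sim_i,\approx$ are equivalence relations on $S$. For $s,t\in S$ and $X\subseteq V$, write $X_s=X_t$ iff $U(s,x)=U(t,x)$ for all $x\in X$, and $X_s\neq X_t$ otherwise. Semantics of the dependency formulas (for finite $X,Y\subseteq\mathbb{V}$): $\mathcal{M},s\vDash\mathcal{D}_g(X,Y)$ iff there exist $u,v\in S$ with $u\approx v\approx s$, $(V\setminus(X\cup Y))_u=(V\setminus(X\cup Y))_v$, $X_u\neq X_v$ and $Y_u\neq Y_v$; $\mathcal{M},s\vDash\mathcal{D}_l(X,Y)$ iff there exists $t\in S$ with $t\approx s$, $(V\setminus(X\cup Y))_t=(V\setminus(X\cup Y))_s$, $X_t\neq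 X_s$ and $Y_t\neq Y_s$. For $u,v\in S$, define $\Delta(u,v)=\{x\in\mathbb{V}\mid U(u,x)\neq U(v,x)\}$ if $(V\setminus\mathbb{V})_u=(V\setminus\mathbb{V})_v$, and $\Delta(u,v)=\emptyset$ otherwise. A set $W$ is an evidence of $\langle X,Y\rangle$ iff $W\cap X\neq\emptyset$, $W\cap Y\neq\emptyset$ and $W\subseteq X\cup Y$. -}

module Defs where

open import Data.Nat using (ℕ)
open import Data.Bool using (Bool)
open import Data.Empty using (⊥)
open import Data.Unit using (⊤)
open import Data.Product using (Σ; ∃; _×_; _,_)
open import Data.Sum using (_⊎_; inj₁; inj₂)
open import Data.List using (List)
open import Data.List.Membership.Propositional using (_∈_)
open import Relation.Nullary using (¬_)
open import Relation.Binary.PropositionalEquality using (_≡_; _≢_)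
open import Relation.Binary.Structures using (IsEquivalence)
open import Function.Definitions using (Injective)

Countable : Set → Set
Countable A = Σ (A → ℕ) (Injective _≡_ _≡_)

-- The model's variable set V ⊇ 𝕍 is
-- represented as the disjoint union Var ⊎ Extra, where Extra = V ∖ 𝕍.
record DEM (Prop Var Agent : Set) : Set₁ where
  field
    S        : Set
    T        : S → Prop → Bool
    Extra    : Set
    extraCountable : Countable Extra
    U        : S → (Var ⊎ Extra) → ℕ
    _∼[_]_   : S → Agent → S → Set
    ∼-equiv  : (i : Agent) → IsEquivalence (λ s t → s ∼[ i ] t)
    _≈_      : S → S → Set
    ≈-equiv  : IsEquivalence _≈_

module _ {Prop Var Agent : Set} (M : DEM Prop Var Agent) where
  open DEM M

  V : Set
  V = Var ⊎ Extra

  InVars : List Var → V → Set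
  InVars X (inj₁ x) = x ∈ X
  InVars X (inj₂ _) = ⊥

  IsExtra : V → Set
  IsExtra (inj₁ _) = ⊥
  IsExtra (inj₂ _) = ⊤

  Agree : (V → Set) → S → S → Set
  Agree P s t = ∀ z → P z → U s z ≡ U t z

  Compl : List Var → List Var → V → Set
  Compl X Y z = ¬ (InVars X z ⊎ InVars Y z)

  Dg : S → List Var → List Var → Set
  Dg s X Y = ∃ λ u → ∃ λ v → u ≈ v × v ≈ s
    × Agree (Compl X Y) u v
    × ¬ Agree (InVars X) u v
    × ¬ Agree (InVars Y) u v

  Dl : S → List Var → List Var → Set
  Dl s X Y = ∃ λ t → t ≈ s
    × Agree (Compl X Y) t s
    × ¬ Agree (InVars X) t s
    × ¬ Agree (InVars Y) t s

  -- Δ(u,v) ⊆ 𝕍, as a predicate: x ∈ Δ(u,v) iff (V∖𝕍)_u = (V∖𝕍)_v and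
  -- U(u,x) ≠ U(v,x)  (so Δ(u,v) = ∅ when (V∖𝕍)_u ≠ (V∖𝕍)_v)
  Δ : S → S → Var → Set
  Δ u v x = Agree IsExtra u v × U u (inj₁ x) ≢ U v (inj₁ x)

Evidence : {Var : Set} → (Var → Set) → List Var → List Var → Set
Evidence W X Y =
    (∃ λ x → W x × x ∈ X)
  × (∃ λ y → W y × y ∈ Y)
  × (∀ z → W z → z ∈ X ⊎ z ∈ Y)

-- Agreement of u and v off X ∪ Y says exactly that they agree on V ∖ 𝕍 (the side condition of Δ)
-- and that Δ(u,v) ⊆ X ∪ Y; disagreement on X (resp. Y) then gives a point of Δ(u,v) in X (resp. Y).
-- The case distinctions involved are constructive: values in ℕ have decidable equality, and so do
-- variables, by countability.
module Submission where

open import Defs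
open import Data.Product using (∃; _×_)
open import Data.List using (List)
open import Function.Bundles using (_⇔_)

open import Data.Nat using (_≟_)
open import Data.Product using (_,_; map₂)
open import Data.Sum using (_⊎_; inj₁; inj₂)
open import Data.Unit using (tt)
open import Data.List.Membership.Propositional using (_∈_; find)
import Data.List.Membership.DecPropositional as DecMembership
open import Data.List.Relation.Unary.All using (lookup)
open import Data.List.Relation.Unary.All.Properties using (¬All⇒Any¬)
open import Function.Bundles using (mk⇔; mk↣)
open import Relation.Binary.Definitions using (DecidableEquality)
open import Relation.Binary.PropositionalEquality using (_≢_)
open import Relation.Nullary using (¬_)
open import Relation.Nullary.Decidable using (via-injection; decidable-stable; _⊎-dec_)

Countable⇒DecidableEquality : {A : Set} → Countable A → DecidableEquality A
Countable⇒DecidableEquality (code , code-injective) =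
  via-injection (mk↣ code-injective) _≟_

module _ {Prop Var Agent : Set} (M : DEM Prop Var Agent) where
  open DEM M

  -- 𝒟_g and 𝒟_l unfold definitionally to existentials ending in this triple.
  DependencePair : S → S → List Var → List Var → Set
  DependencePair u v X Y =
    Agree M (Compl M X Y) u v × ¬ Agree M (InVars M X) u v × ¬ Agree M (InVars M Y) u v

  Agree-Compl⇒Agree-IsExtra : ∀ {X Y u v} → Agree M (Compl M X Y) u v → Agree M (IsExtra M) u v
  Agree-Compl⇒Agree-IsExtra agree (inj₂ e) _ = agree (inj₂ e) λ { (inj₁ ()) ; (inj₂ ()) }

  ¬Agree⇒∃-differs : ∀ {Z u v} → ¬ Agree M (InVars M Z) u v →
    ∃ λ x → x ∈ Z × U u (inj₁ x) ≢ U v (inj₁ x)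
  ¬Agree⇒∃-differs {Z} {u} {v} disagree =
    find (¬All⇒Any¬ (λ x → U u (inj₁ x) ≟ U v (inj₁ x)) Z
           λ agreeAll → disagree λ { (inj₁ x) x∈Z → lookup agreeAll x∈Z })

  DependencePair⇒Evidence : DecidableEquality Var → ∀ {X Y u v} →
    DependencePair u v X Y → Evidence (Δ M u v) X Y
  DependencePair⇒Evidence _≟ᵥ_ {X} {Y} {u} {v} (agree , disagreeX , disagreeY) =
    differsIn disagreeX , differsIn disagreeY , covered
    where
    open DecMembership _≟ᵥ_ using (_∈?_)

    differsIn : ∀ {Z} → ¬ Agree M (InVars M Z) u v → ∃ λ x → Δ M u v x × x ∈ Z
    differsIn disagree with ¬Agree⇒∃-differs disagree
    ... | x , x∈Z , differs = x , (Agree-Compl⇒Agree-IsExtra agree , differs) , x∈Z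

    covered : ∀ z → Δ M u v z → z ∈ X ⊎ z ∈ Y
    covered z (_ , differs) =
      decidable-stable (z ∈? X ⊎-dec z ∈? Y) λ z∉X∪Y → differs (agree (inj₁ z) z∉X∪Y)

  Evidence⇒DependencePair : ∀ {X Y u v} → Evidence (Δ M u v) X Y → DependencePair u v X Y
  Evidence⇒DependencePair {X} {Y} {u} {v}
    ((x , (agreeExtra , differsX) , x∈X) , (y , (_ , differsY) , y∈Y) , covered) =
    agree , (λ agreeX → differsX (agreeX (inj₁ x) x∈X)) , (λ agreeY → differsY (agreeY (inj₁ y) y∈Y))
    where
    agree : Agree M (Compl M X Y) u v
    agree (inj₁ z) z∉X∪Y =
      decidable-stable (U u (inj₁ z) ≟ U v (inj₁ z)) λ differs → z∉X∪Y (covered z (agreeExtra , differs))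
    agree (inj₂ e) _ = agreeExtra (inj₂ e) tt

mainTheorem1 : (Prop Var Agent : Set) → Countable Prop → Countable Var →
    (M : DEM Prop Var Agent) → (s : DEM.S M) → (X Y : List Var) →
    (Dg M s X Y ⇔ (∃ λ u → ∃ λ v → DEM._≈_ M u v × DEM._≈_ M v s × Evidence (Δ M u v) X Y))
    × (Dl M s X Y ⇔ (∃ λ t → DEM._≈_ M t s × Evidence (Δ M t s) X Y))
mainTheorem1 _ _ _ _ countableVar M s X Y =
    mk⇔ (map₂ (map₂ (map₂ (map₂ toEvidence)))) (map₂ (map₂ (map₂ (map₂ fromEvidence))))
  , mk⇔ (map₂ (map₂ toEvidence)) (map₂ (map₂ fromEvidence))
  where
  toEvidence : ∀ {u v} → DependencePair M u v X Y → Evidence (Δ M u v) X Y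
  toEvidence = DependencePair⇒Evidence M (Countable⇒DecidableEquality countableVar)

  fromEvidence : ∀ {u v} → Evidence (Δ M u v) X Y → DependencePair M u v X Y
  fromEvidence = Evidence⇒DependencePair M
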